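{- For any connected graph $G$ and any integer $k\ge c(G)$, $\mathrm{capt}_k(G)\ge \frac{\mathrm{diam}(G)-k+1}{2k}$.
   Context: Graphs are finite, undirected and reflexive. The game of Cops and Robbers on $G$: a set of cops first each choose a starting vertex (round 0), then the robber chooses a starting vertex; then the players alternate, in each round any subset of cops moving to adjacent vertices (staying put allowed), then the robber moving to an adjacent vertex or staying put. Cops win if some cop occupies the robber's vertex. The cop number $c(G)$ is the least number of cops having a winning strategy. For $k\ge c(G)$, $\mathrm{capt}_k(G)$ is the minimum over $k$-cop strategies of the number of rounds (not counting round 0) until capture against a robber delaying capture as long as possible. $\mathrm{diam}(G)$ is the diameter of $G$. -}

module Defs where

open import Data.Nat using (ℕ; zero; suc; _≤_; _<_)
open import Data.Fin using (Fin)
open import Data.Bool using (Bool; T)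
open import Data.Product using (Σ; ∃; ∃-syntax; _×_; _,_)
open import Data.Sum using (_⊎_)
open import Relation.Nullary using (¬_)
open import Relation.Binary.PropositionalEquality using (_≡_)

record Graph : Set where
  field
    n     : ℕ
    adj   : Fin n → Fin n → Bool
    refl  : ∀ v → T (adj v v)
    sym   : ∀ u v → T (adj u v) → T (adj v u)

module _ (G : Graph) where
  open Graph G

  Vertex : Set
  Vertex = Fin n

  Adj : Vertex → Vertex → Set
  Adj u v = T (adj u v)

  data Walk : Vertex → Vertex → ℕ → Set where
    here : ∀ {v} → Walk v v zero
    step : ∀ {u w v m} → Adj u w → Walk w v m → Walk u v (suc m)

  Connected : Set
  Connected = ∀ u v → ∃[ m ] Walk u v m

  IsDist : Vertex → Vertex → ℕ → Set
  IsDist u v d = Walk u v d × (∀ m → Walk u v m → d ≤ m)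

  IsDiam : ℕ → Set
  IsDiam D = (∃[ u ] ∃[ v ] IsDist u v D)
           × (∀ u v d → IsDist u v d → d ≤ D)

  Cops : ℕ → Set
  Cops k = Fin k → Vertex

  Captured : ∀ {k} → Cops k → Vertex → Set
  Captured {k} c r = ∃[ i ] c i ≡ r

  CopMove : ∀ {k} → Cops k → Cops k → Set
  CopMove {k} c c' = ∀ i → Adj (c i) (c' i)

  -- WinWithin k t c r : with cops at c and robber at r, cops to move,
  -- the cops can force capture within t further rounds.
  WinWithin : (k : ℕ) → ℕ → Cops k → Vertex → Set
  WinWithin k zero    c r = Captured c r
  WinWithin k (suc t) c r =
    Captured c r ⊎
    (∃[ c' ] CopMove c c' ×
      (Captured c' r ⊎ (∀ r' → Adj r r' → WinWithin k t c' r')))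

  CaptureWithin : ℕ → ℕ → Set
  CaptureWithin k t = ∃[ c₀ ] (∀ r₀ → WinWithin k t c₀ r₀)

  CopsWin : ℕ → Set
  CopsWin k = ∃[ t ] CaptureWithin k t

  IsCopNumber : ℕ → Set
  IsCopNumber c = CopsWin c × (∀ j → j < c → ¬ CopsWin j)

  IsCapt : ℕ → ℕ → Set
  IsCapt k t = CaptureWithin k t × (∀ s → s < t → ¬ CaptureWithin k s)

-- Fix a geodesic x₀ … x_D of length D = diam G and a k-cop strategy capturing
-- within t rounds from the start c₀. Against a robber sitting still at x_j the
-- strategy still wins, so some cop starts within distance t of x_j. If one cop
-- is near both x_i and x_j (i < j), there is a walk of length ≤ 2t from x_i to
-- x_j, and since the geodesic is shortest, j − i ≤ 2t. So each cop accounts for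
-- a set of path positions of span < 2t + 1, and D + 1 ≤ k (2t + 1).
module Submission where

open import Defs
open import Data.Nat using (ℕ; zero; suc; _≤_; _<_; _+_; _*_; _∸_; _%_; _/_; NonZero; z≤n; s≤s)
open import Data.Nat.Properties
open import Data.Nat.DivMod using (m≡m%n+[m/n]*n; m%n<n; /-mono-≤)
open import Data.Nat.Tactic.RingSolver using (solve-∀)
open import Data.Fin as Fin using (Fin; toℕ; fromℕ<; combine)
open import Data.Fin.Properties using (pigeonhole; combine-injectiveˡ; combine-injectiveʳ; toℕ-fromℕ<; toℕ<n)
open import Data.Product using (∃-syntax; _×_; _,_; proj₁)
open import Data.Sum using (inj₁; inj₂)
open import Data.Empty using (⊥-elim)
open import Relation.Nullary using (¬_)
open import Relation.Binary.PropositionalEquality using (_≡_; refl; cong; cong₂; subst; module ≡-Reasoning)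

%-injectiveOn-window : ∀ {n a b} .{{_ : NonZero n}} →
  a ≤ b → b < a + n → a % n ≡ b % n → a ≡ b
%-injectiveOn-window {n} {a} {b} a≤b b<a+n a%n≡b%n
  with m≤n⇒m<n∨m≡n (/-mono-≤ a≤b (≤-refl {n}))
... | inj₁ a/n<b/n = ⊥-elim (<⇒≱ b<a+n (a+n≤b a/n<b/n))
  where
  open ≤-Reasoning
  a+n≤b : a / n < b / n → a + n ≤ b
  a+n≤b a/n<b/n = begin
    a + n                        ≡⟨ cong (_+ n) (m≡m%n+[m/n]*n a n) ⟩
    a % n + (a / n) * n + n      ≡⟨ +-assoc (a % n) _ n ⟩
    a % n + ((a / n) * n + n)    ≡⟨ cong₂ _+_ a%n≡b%n (+-comm _ n) ⟩
    b % n + suc (a / n) * n      ≤⟨ +-monoʳ-≤ (b % n) (*-monoˡ-≤ n a/n<b/n) ⟩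
    b % n + (b / n) * n          ≡⟨ m≡m%n+[m/n]*n b n ⟨
    b                            ∎
... | inj₂ a/n≡b/n = begin
  a                      ≡⟨ m≡m%n+[m/n]*n a n ⟩
  a % n + (a / n) * n    ≡⟨ cong₂ (λ r q → r + q * n) a%n≡b%n a/n≡b/n ⟩
  b % n + (b / n) * n    ≡⟨ m≡m%n+[m/n]*n b n ⟨
  b                      ∎
  where open ≡-Reasoning

-- Pigeonhole on (colour, position mod M): two points sharing both would be a
-- same-coloured pair at distance in (0, M), which the span hypothesis excludes.
colouring-span-bound : ∀ {N k} M .{{_ : NonZero M}} (colour : Fin N → Fin k) →
  (∀ i j → i Fin.< j → colour i ≡ colour j → toℕ j < toℕ i + M) →
  N ≤ k * M
colouring-span-bound {N} {k} M colour span = ≮⇒≥ kM≮N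
  where
  residue : Fin N → Fin M
  residue j = fromℕ< (m%n<n (toℕ j) M)

  kM≮N : ¬ k * M < N
  kM≮N kM<N with pigeonhole kM<N (λ j → combine (colour j) (residue j))
  ... | i , j , i<j , same = <-irrefl i≡j i<j
    where
    same-residue : toℕ i % M ≡ toℕ j % M
    same-residue = begin
      toℕ i % M          ≡⟨ toℕ-fromℕ< (m%n<n (toℕ i) M) ⟨
      toℕ (residue i)    ≡⟨ cong toℕ (combine-injectiveʳ (colour i) _ (colour j) _ same) ⟩
      toℕ (residue j)    ≡⟨ toℕ-fromℕ< (m%n<n (toℕ j) M) ⟩
      toℕ j % M          ∎
      where open ≡-Reasoning

    i≡j : toℕ i ≡ toℕ j
    i≡j = %-injectiveOn-window (<⇒≤ i<j)
            (span i j i<j (combine-injectiveˡ (colour i) _ (colour j) _ same))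
            same-residue

module _ {G : Graph} where

  infixr 5 _++ʷ_

  _++ʷ_ : ∀ {u w v a b} → Walk G u w a → Walk G w v b → Walk G u v (a + b)
  here     ++ʷ q = q
  step e p ++ʷ q = step e (p ++ʷ q)

  snocʷ : ∀ {u w v a} → Walk G u w a → Adj G w v → Walk G u v (suc a)
  snocʷ here       e = step e here
  snocʷ (step d p) e = step d (snocʷ p e)

  reverseʷ : ∀ {u v a} → Walk G u v a → Walk G v u a
  reverseʷ here               = here
  reverseʷ (step {u} {w} e p) = snocʷ (reverseʷ p) (Graph.sym G u w e)

  -- Positions beyond the end of the walk give its last vertex.
  vertexAt : ∀ {u v m} → Walk G u v m → ℕ → Vertex G
  vertexAt {u} here       _       = u
  vertexAt {u} (step e p) zero    = u
  vertexAt     (step e p) (suc j) = vertexAt p j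

  takeʷ : ∀ {u v m} (p : Walk G u v m) j → j ≤ m → Walk G u (vertexAt p j) j
  takeʷ here       zero    _         = here
  takeʷ (step e p) zero    _         = here
  takeʷ (step e p) (suc j) (s≤s j≤m) = step e (takeʷ p j j≤m)

  dropʷ : ∀ {u v m} (p : Walk G u v m) j → j ≤ m → Walk G (vertexAt p j) v (m ∸ j)
  dropʷ here       zero    _         = here
  dropʷ (step e p) zero    _         = step e p
  dropʷ (step e p) (suc j) (s≤s j≤m) = dropʷ p j j≤m

  shortest-shortcut : ∀ {u v d m} (p : Walk G u v d) → (∀ l → Walk G u v l → d ≤ l) →
    ∀ {a b} (a≤b : a ≤ b) (b≤d : b ≤ d) →
    Walk G (vertexAt p a) (vertexAt p b) m → b ≤ a + m
  shortest-shortcut {u} {v} {d} {m} p shortest {a} {b} a≤b b≤d q =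
    +-cancelʳ-≤ (d ∸ b) b (a + m) (begin
      b + (d ∸ b)           ≡⟨ m+[n∸m]≡n b≤d ⟩
      d                     ≤⟨ shortest _ detour ⟩
      a + (m + (d ∸ b))     ≡⟨ +-assoc a m (d ∸ b) ⟨
      a + m + (d ∸ b)       ∎)
    where
    open ≤-Reasoning
    detour : Walk G u v (a + (m + (d ∸ b)))
    detour = takeʷ p a (≤-trans a≤b b≤d) ++ʷ q ++ʷ dropʷ p b b≤d

  winWithin⇒copNear : ∀ {k} t (c : Cops G k) r → WinWithin G k t c r →
    ∃[ i ] ∃[ m ] m ≤ t × Walk G (c i) r m
  winWithin⇒copNear zero    c r (i , refl) = i , 0 , z≤n , here
  winWithin⇒copNear (suc t) c r (inj₁ (i , refl)) = i , 0 , z≤n , here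
  winWithin⇒copNear (suc t) c r (inj₂ (c' , move , inj₁ (i , refl))) =
    i , 1 , s≤s z≤n , step (move i) here
  winWithin⇒copNear (suc t) c r (inj₂ (c' , move , inj₂ win))
    with winWithin⇒copNear t c' r (win r (Graph.refl G r))
  ... | i , m , m≤t , w = i , suc m , s≤s m≤t , step (move i) w

corollary2p3 : (G : Graph) → Connected G →
    (c : ℕ) → IsCopNumber G c → (k : ℕ) → c ≤ k →
    (D : ℕ) → IsDiam G D → (t : ℕ) → IsCapt G k t →
    D + 1 ≤ 2 * k * t + k
corollary2p3 G _ _ _ k _ D ((_ , _ , geodesic , shortest) , _) t ((c₀ , win) , _) =
  subst (D + 1 ≤_) (k[2t+1]≡2kt+k k t)
    (colouring-span-bound (suc (t + t)) nearbyCop sharedCop⇒close)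
  where
  k[2t+1]≡2kt+k : ∀ k t → k * suc (t + t) ≡ 2 * k * t + k
  k[2t+1]≡2kt+k = solve-∀

  onGeodesic : Fin (D + 1) → Vertex G
  onGeodesic j = vertexAt geodesic (toℕ j)

  position≤D : (j : Fin (D + 1)) → toℕ j ≤ D
  position≤D j = m<1+n⇒m≤n (subst (toℕ j <_) (+-comm D 1) (toℕ<n j))

  nearbyCop : Fin (D + 1) → Fin k
  nearbyCop j = proj₁ (winWithin⇒copNear t c₀ (onGeodesic j) (win _))

  sharedCop⇒close : ∀ i j → i Fin.< j → nearbyCop i ≡ nearbyCop j →
    toℕ j < toℕ i + suc (t + t)
  sharedCop⇒close i j i<j same
    with winWithin⇒copNear t c₀ (onGeodesic i) (win _)
       | winWithin⇒copNear t c₀ (onGeodesic j) (win _)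
  sharedCop⇒close i j i<j refl | x , m₁ , m₁≤t , toI | .x , m₂ , m₂≤t , toJ =
    begin-strict
      toℕ j                  ≤⟨ shortest-shortcut geodesic shortest (<⇒≤ i<j) (position≤D j)
                                  (reverseʷ toI ++ʷ toJ) ⟩
      toℕ i + (m₁ + m₂)      ≤⟨ +-monoʳ-≤ (toℕ i) (+-mono-≤ m₁≤t m₂≤t) ⟩
      toℕ i + (t + t)        <⟨ +-monoʳ-< (toℕ i) ≤-refl ⟩
      toℕ i + suc (t + t)    ∎
    where open ≤-Reasoning
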